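{- Let $a,b,u$ be indeterminates and let $g=g(x)$ be the formal power series solution of the differential equation \[g'=u\,g^{b+1}+a\,x\,g^{b}g'\] with $g(0)=1$, where the prime denotes the derivative with respect to $x$. Then, for an indeterminate $c$, \[g^c=\sum_{n=0}^\infty P_n(a,bu,cu)\frac{x^n}{n!}\qquad\text{and}\qquad \log g=\sum_{n=1}^\infty u\,Q_n(a,bu)\frac{x^n}{n!}.\]
   Context: For $n\ge1$, $P_n(a,b,c)=c\prod_{i=1}^{n-1}(ia+(n-i)b+c)$, with the convention $P_0(a,b,c)=1$, and $Q_n(a,b)=\prod_{i=1}^{n-1}(ia+(n-i)b)$ is the coefficient of $c$ in $P_n(a,b,c)$. Powers $g^c$ of a power series with constant term $1$ are defined by $g^c=\exp(c\log g)$. -}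

module Defs where

open import Level using (Level; _⊔_)
open import Data.Nat using (ℕ; zero; suc; _∸_)
open import Algebra.Bundles using (CommutativeRing)

ιR : {c ℓ : Level} (R : CommutativeRing c ℓ) → ℕ → CommutativeRing.Carrier R
ιR R zero    = CommutativeRing.0# R
ιR R (suc n) = CommutativeRing._+_ R (CommutativeRing.1# R) (ιR R n)

-- A commutative ℚ-algebra: a commutative ring in which every positive
-- integer n+1 is invertible; `inv n` is the inverse of n+1.
record QAlgebra (c ℓ : Level) : Set (Level.suc (c ⊔ ℓ)) where
  field
    cring : CommutativeRing c ℓ
  open CommutativeRing cring public
  field
    inv     : ℕ → Carrier
    inv-spec : ∀ n → ιR cring (suc n) * inv n ≈ 1#
  ι : ℕ → Carrier
  ι = ιR cring

module _ {c ℓ : Level} (A : QAlgebra c ℓ) where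
  open QAlgebra A

  PS : Set c
  PS = ℕ → Carrier

  sumTo : (ℕ → Carrier) → ℕ → Carrier
  sumTo f zero    = 0#
  sumTo f (suc n) = sumTo f n + f n

  prodTo : (ℕ → Carrier) → ℕ → Carrier
  prodTo f zero    = 1#
  prodTo f (suc n) = prodTo f n * f n

  invFact : ℕ → Carrier
  invFact zero    = 1#
  invFact (suc n) = inv n * invFact n

  onePS : PS
  onePS zero    = 1#
  onePS (suc n) = 0#

  _⊛_ : PS → PS → PS
  (f ⊛ g) n = sumTo (λ k → f k * g (n ∸ k)) (suc n)

  pow : PS → ℕ → PS
  pow f zero    = onePS
  pow f (suc k) = f ⊛ pow f k

  _·_ : Carrier → PS → PS
  (r · f) n = r * f n

  _⊕_ : PS → PS → PS
  (f ⊕ g) n = f n + g n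

  xMul : PS → PS
  xMul f zero    = 0#
  xMul f (suc n) = f n

  D : PS → PS
  D f n = ι (suc n) * f (suc n)

  sgn : ℕ → Carrier
  sgn zero    = 1#
  sgn (suc k) = - sgn k

  -- log g = Σ_{k≥1} (-1)^{k+1} (g-1)^k / k   (for g with constant term 1;
  -- the constant term of g is ignored, i.e. treated as 1).
  -- Coefficient n only involves k ≤ n since (g-1)^k = O(x^k).
  logPS : PS → PS
  logPS g n = sumTo (λ k → sgn k * inv k * pow h (suc k) n) n
    where
    h : PS
    h zero    = 0#
    h (suc m) = g (suc m)

  -- exp f = Σ_{k≥0} f^k / k!   (for f with constant term 0;
  -- the constant term of f is ignored, i.e. treated as 0).
  expPS : PS → PS
  expPS f n = sumTo (λ k → invFact k * pow f₀ k n) (suc n)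
    where
    f₀ : PS
    f₀ zero    = 0#
    f₀ (suc m) = f (suc m)

  powPS : PS → Carrier → PS
  powPS g e = expPS (e · logPS g)

  -- P_n(a,b,c) = c Π_{i=1}^{n-1} (i a + (n-i) b + c),  P_0 = 1
  P : ℕ → Carrier → Carrier → Carrier → Carrier
  P zero    a b c' = 1#
  P (suc m) a b c' =
    c' * prodTo (λ j → ι (suc j) * a + ι (m ∸ j) * b + c') m

  -- Q_n(a,b) = Π_{i=1}^{n-1} (i a + (n-i) b)  (used for n ≥ 1)
  Q : ℕ → Carrier → Carrier → Carrier
  Q zero    a b = 1#
  Q (suc m) a b = prodTo (λ j → ι (suc j) * a + ι (m ∸ j) * b) m

{-# OPTIONS --safe #-}
-- Write L = log g and M = L′.  Since (exp f)′ = f′ exp f, the series g^e = exp (e L) is the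
-- unique solution of Y′ = e M Y with Y(0) = 1; hence g^e g^f = g^(e+f), and, as g L′ = g′,
-- also g = g^1.  Put N_e = M g^e = g^(e-1) g′.  Multiplying the differential equation by
-- g^(e-1) gives N_e = u g^(e+b) + a x N_(e+b), that is
--   (n+1) N_e[n+1] = ((n+1) a + b u + e u) N_(e+b)[n],    N_e[0] = u.
-- Running over the whole family e ↦ N_e at once, this recurrence determines N, and
-- u Π_{j<n} ((j+1) a + (n-j) b u + e u) / n! satisfies it.  Both formulas then follow from
-- g^e[n+1] = e N_e[n] / (n+1) and (log g)[n+1] = N_0[n] / (n+1).
module Submission where

open import Level using (Level)
open import Data.Nat using (ℕ; zero; suc; _∸_; _≤_; _<_; _<?_; z≤n; s≤s)
  renaming (_+_ to _+ℕ_)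
import Data.Nat.Properties as ℕ
open import Data.Nat.Induction using (<-rec)
open import Data.Product using (_×_; _,_)
open import Data.Sum using (inj₁; inj₂)
open import Relation.Nullary using (yes; no)
import Relation.Binary.PropositionalEquality as ≡
import Defs
open Defs using (QAlgebra)

module FormalPowerSeries {c ℓ : Level} (A : QAlgebra c ℓ) where
  open QAlgebra A
  open import Relation.Binary.Reasoning.Setoid setoid
  open import Algebra.Solver.Ring.NaturalCoefficients.Default commutativeSemiring
    using (solve; _:+_; _:*_; _:=_; con)

  PS : Set c
  PS = Defs.PS A

  sumTo : (ℕ → Carrier) → ℕ → Carrier
  sumTo = Defs.sumTo A

  prodTo : (ℕ → Carrier) → ℕ → Carrier
  prodTo = Defs.prodTo A

  invFact : ℕ → Carrier
  invFact = Defs.invFact A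

  sgn : ℕ → Carrier
  sgn = Defs.sgn A

  onePS : PS
  onePS = Defs.onePS A

  infixl 7 _⊛_
  _⊛_ : PS → PS → PS
  _⊛_ = Defs._⊛_ A

  infixl 6 _⊕_
  _⊕_ : PS → PS → PS
  _⊕_ = Defs._⊕_ A

  infixr 8 _·_
  _·_ : Carrier → PS → PS
  _·_ = Defs._·_ A

  pow : PS → ℕ → PS
  pow = Defs.pow A

  xMul : PS → PS
  xMul = Defs.xMul A

  D : PS → PS
  D = Defs.D A

  expPS : PS → PS
  expPS = Defs.expPS A

  logPS : PS → PS
  logPS = Defs.logPS A

  powPS : PS → Carrier → PS
  powPS = Defs.powPS A

  P : ℕ → Carrier → Carrier → Carrier → Carrier
  P = Defs.P A

  Q : ℕ → Carrier → Carrier → Carrier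
  Q = Defs.Q A

  sumTo-cong-< : ∀ {f g} n → (∀ k → k < n → f k ≈ g k) → sumTo f n ≈ sumTo g n
  sumTo-cong-< zero    f≈g = refl
  sumTo-cong-< (suc n) f≈g =
    +-cong (sumTo-cong-< n (λ k k<n → f≈g k (ℕ.m<n⇒m<1+n k<n))) (f≈g n ℕ.≤-refl)

  sumTo-cong : ∀ {f g} n → (∀ k → f k ≈ g k) → sumTo f n ≈ sumTo g n
  sumTo-cong n f≈g = sumTo-cong-< n (λ k _ → f≈g k)

  sumTo-zero : ∀ {f} n → (∀ k → k < n → f k ≈ 0#) → sumTo f n ≈ 0#
  sumTo-zero zero    f≈0 = refl
  sumTo-zero (suc n) f≈0 =
    trans (+-cong (sumTo-zero n (λ k k<n → f≈0 k (ℕ.m<n⇒m<1+n k<n))) (f≈0 n ℕ.≤-refl))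
          (+-identityʳ 0#)

  sumTo-+ : ∀ f g n → sumTo (λ k → f k + g k) n ≈ sumTo f n + sumTo g n
  sumTo-+ f g zero    = sym (+-identityʳ 0#)
  sumTo-+ f g (suc n) = trans (+-congʳ (sumTo-+ f g n))
    (solve 4 (λ s t x y → (s :+ t) :+ (x :+ y) := (s :+ x) :+ (t :+ y)) refl _ _ _ _)

  *-distribˡ-sumTo : ∀ r f n → r * sumTo f n ≈ sumTo (λ k → r * f k) n
  *-distribˡ-sumTo r f zero    = zeroʳ r
  *-distribˡ-sumTo r f (suc n) = trans (distribˡ r _ _) (+-congʳ (*-distribˡ-sumTo r f n))

  *-distribʳ-sumTo : ∀ r f n → sumTo f n * r ≈ sumTo (λ k → f k * r) n
  *-distribʳ-sumTo r f n =
    trans (*-comm _ r) (trans (*-distribˡ-sumTo r f n) (sumTo-cong n (λ k → *-comm r (f k))))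

  sumTo-head : ∀ f n → sumTo f (suc n) ≈ f 0 + sumTo (λ k → f (suc k)) n
  sumTo-head f zero    = trans (+-identityˡ _) (sym (+-identityʳ _))
  sumTo-head f (suc n) = trans (+-congʳ (sumTo-head f n)) (+-assoc _ _ _)

  sumTo-swap : ∀ (F : ℕ → ℕ → Carrier) m n →
    sumTo (λ i → sumTo (λ j → F i j) n) m ≈ sumTo (λ j → sumTo (λ i → F i j) m) n
  sumTo-swap F zero    n = sym (sumTo-zero n (λ _ _ → refl))
  sumTo-swap F (suc m) n = trans (+-congʳ (sumTo-swap F m n)) (sym (sumTo-+ _ _ n))

  sumTo-truncate : ∀ {f} m n → m ≤ n → (∀ k → m ≤ k → k < n → f k ≈ 0#) →
    sumTo f n ≈ sumTo f m
  sumTo-truncate {f} m zero    z≤n _   = refl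
  sumTo-truncate {f} m (suc n) m≤1+n f≈0 with ℕ.m≤n⇒m<n∨m≡n m≤1+n
  ... | inj₂ ≡.refl = refl
  ... | inj₁ m<1+n  =
    trans (+-cong (sumTo-truncate m n m≤n (λ k m≤k k<n → f≈0 k m≤k (ℕ.m<n⇒m<1+n k<n)))
                  (f≈0 n m≤n ℕ.≤-refl))
          (+-identityʳ _)
    where m≤n = ℕ.m<1+n⇒m≤n m<1+n

  sumTo-reverse : ∀ f n → sumTo f (suc n) ≈ sumTo (λ k → f (n ∸ k)) (suc n)
  sumTo-reverse f zero    = refl
  sumTo-reverse f (suc n) = sym (begin
    sumTo (λ k → f (suc n ∸ k)) (suc (suc n))   ≈⟨ sumTo-head (λ k → f (suc n ∸ k)) (suc n) ⟩
    f (suc n) + sumTo (λ k → f (n ∸ k)) (suc n) ≈⟨ +-congˡ (sumTo-reverse f n) ⟨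
    f (suc n) + sumTo f (suc n)                 ≈⟨ +-comm _ _ ⟩
    sumTo f (suc (suc n))                       ∎)

  sumTo-triangle : ∀ (F : ℕ → ℕ → Carrier) n →
    sumTo (λ i → sumTo (λ j → F i j) (suc i)) (suc n) ≈
    sumTo (λ j → sumTo (λ t → F (j +ℕ t) j) (suc (n ∸ j))) (suc n)
  sumTo-triangle F zero    = refl
  sumTo-triangle F (suc n) = sym (begin
    sumTo (λ j → sumTo (λ t → F (j +ℕ t) j) (suc (suc n ∸ j))) (suc (suc n))
      ≈⟨ sumTo-cong-< (suc (suc n)) (λ j j≤1+n →
           +-congˡ (reflexive (≡.cong (λ t → F t j) (ℕ.m+[n∸m]≡n (ℕ.m<1+n⇒m≤n j≤1+n))))) ⟩
    sumTo (λ j → H j + F (suc n) j) (suc (suc n))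
      ≈⟨ sumTo-+ H (F (suc n)) (suc (suc n)) ⟩
    (sumTo H (suc n) + H (suc n)) + sumTo (F (suc n)) (suc (suc n))
      ≈⟨ +-congʳ (+-cong (sumTo-cong-< (suc n) (λ j j≤n →
                            reflexive (≡.cong (sumTo _) (ℕ.+-∸-assoc 1 (ℕ.m<1+n⇒m≤n j≤n)))))
                         (reflexive (≡.cong (sumTo _) (ℕ.n∸n≡0 n)))) ⟩
    (sumTo (λ j → sumTo (λ t → F (j +ℕ t) j) (suc (n ∸ j))) (suc n) + 0#)
      + sumTo (F (suc n)) (suc (suc n))
      ≈⟨ +-congʳ (trans (+-identityʳ _) (sym (sumTo-triangle F n))) ⟩
    sumTo (λ i → sumTo (λ j → F i j) (suc i)) (suc n) + sumTo (F (suc n)) (suc (suc n)) ∎)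
    where
    H : ℕ → Carrier
    H j = sumTo (λ t → F (j +ℕ t) j) (suc n ∸ j)

  prodTo-cong-< : ∀ {f g} n → (∀ k → k < n → f k ≈ g k) → prodTo f n ≈ prodTo g n
  prodTo-cong-< zero    f≈g = refl
  prodTo-cong-< (suc n) f≈g =
    *-cong (prodTo-cong-< n (λ k k<n → f≈g k (ℕ.m<n⇒m<1+n k<n))) (f≈g n ℕ.≤-refl)

  ι-+ : ∀ m n → ι (m +ℕ n) ≈ ι m + ι n
  ι-+ zero    n = sym (+-identityˡ _)
  ι-+ (suc m) n = trans (+-congˡ (ι-+ m n)) (sym (+-assoc _ _ _))

  inv-cancelˡ : ∀ n x → inv n * (ι (suc n) * x) ≈ x
  inv-cancelˡ n x = begin
    inv n * (ι (suc n) * x) ≈⟨ solve 3 (λ i m y → i :* (m :* y) := (m :* i) :* y) refl _ _ x ⟩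
    (ι (suc n) * inv n) * x ≈⟨ *-congʳ (inv-spec n) ⟩
    1# * x                  ≈⟨ *-identityˡ x ⟩
    x                       ∎

  cancel-ι-suc : ∀ n {x y} → ι (suc n) * x ≈ y → x ≈ inv n * y
  cancel-ι-suc n {x} n+1*x≈y = trans (sym (inv-cancelˡ n x)) (*-congˡ n+1*x≈y)

  infix 4 _≋_ x^_∣_

  _≋_ : PS → PS → Set ℓ
  f ≋ g = ∀ n → f n ≈ g n

  x^_∣_ : ℕ → PS → Set ℓ
  x^ k ∣ f = ∀ m → m < k → f m ≈ 0#

  ⊛-cong : ∀ {f f′ g g′} → f ≋ f′ → g ≋ g′ → f ⊛ g ≋ f′ ⊛ g′
  ⊛-cong f≋f′ g≋g′ n = sumTo-cong (suc n) (λ k → *-cong (f≋f′ k) (g≋g′ (n ∸ k)))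

  ⊛-congˡ : ∀ f {g g′} → g ≋ g′ → f ⊛ g ≋ f ⊛ g′
  ⊛-congˡ f = ⊛-cong {f} (λ _ → refl)

  ⊛-congʳ : ∀ {f f′} g → f ≋ f′ → f ⊛ g ≋ f′ ⊛ g
  ⊛-congʳ g f≋f′ = ⊛-cong {g = g} f≋f′ (λ _ → refl)

  ⊛-comm : ∀ f g → f ⊛ g ≋ g ⊛ f
  ⊛-comm f g n = begin
    sumTo (λ k → f k * g (n ∸ k)) (suc n)
      ≈⟨ sumTo-reverse (λ k → f k * g (n ∸ k)) n ⟩
    sumTo (λ k → f (n ∸ k) * g (n ∸ (n ∸ k))) (suc n)
      ≈⟨ sumTo-cong-< (suc n) (λ k k≤n →
           trans (*-congˡ (reflexive (≡.cong g (ℕ.m∸[m∸n]≡n (ℕ.m<1+n⇒m≤n k≤n))))) (*-comm _ _)) ⟩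
    sumTo (λ k → g k * f (n ∸ k)) (suc n) ∎

  ⊛-assoc : ∀ f g h → (f ⊛ g) ⊛ h ≋ f ⊛ (g ⊛ h)
  ⊛-assoc f g h n = begin
    sumTo (λ i → sumTo (λ j → f j * g (i ∸ j)) (suc i) * h (n ∸ i)) (suc n)
      ≈⟨ sumTo-cong (suc n) (λ i → *-distribʳ-sumTo (h (n ∸ i)) _ (suc i)) ⟩
    sumTo (λ i → sumTo (λ j → f j * g (i ∸ j) * h (n ∸ i)) (suc i)) (suc n)
      ≈⟨ sumTo-triangle (λ i j → f j * g (i ∸ j) * h (n ∸ i)) n ⟩
    sumTo (λ j → sumTo (λ t → f j * g ((j +ℕ t) ∸ j) * h (n ∸ (j +ℕ t))) (suc (n ∸ j))) (suc n)
      ≈⟨ sumTo-cong (suc n) (λ j → sumTo-cong (suc (n ∸ j)) (λ t →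
           trans (*-cong (*-congˡ (reflexive (≡.cong g (ℕ.m+n∸m≡n j t))))
                         (reflexive (≡.cong h (≡.sym (ℕ.∸-+-assoc n j t)))))
                 (*-assoc _ _ _))) ⟩
    sumTo (λ j → sumTo (λ t → f j * (g t * h ((n ∸ j) ∸ t))) (suc (n ∸ j))) (suc n)
      ≈⟨ sumTo-cong (suc n) (λ j → *-distribˡ-sumTo (f j) _ (suc (n ∸ j))) ⟨
    sumTo (λ j → f j * sumTo (λ t → g t * h ((n ∸ j) ∸ t)) (suc (n ∸ j))) (suc n) ∎

  x⊛yz≋y⊛xz : ∀ f g h → f ⊛ (g ⊛ h) ≋ g ⊛ (f ⊛ h)
  x⊛yz≋y⊛xz f g h n = begin
    (f ⊛ (g ⊛ h)) n ≈⟨ ⊛-assoc f g h n ⟨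
    ((f ⊛ g) ⊛ h) n ≈⟨ ⊛-congʳ h (⊛-comm f g) n ⟩
    ((g ⊛ f) ⊛ h) n ≈⟨ ⊛-assoc g f h n ⟩
    (g ⊛ (f ⊛ h)) n ∎

  ⊛-identityʳ : ∀ f → f ⊛ onePS ≋ f
  ⊛-identityʳ f n = trans (+-cong (sumTo-zero n offDiagonal) diagonal) (+-identityˡ (f n))
    where
    offDiagonal : ∀ k → k < n → f k * onePS (n ∸ k) ≈ 0#
    offDiagonal k k<n with n ∸ k | ℕ.m<n⇒0<n∸m k<n
    ... | suc _ | _ = zeroʳ (f k)
    diagonal : f n * onePS (n ∸ n) ≈ f n
    diagonal rewrite ℕ.n∸n≡0 n = *-identityʳ (f n)

  ⊛-identityˡ : ∀ f → onePS ⊛ f ≋ f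
  ⊛-identityˡ f n = trans (⊛-comm onePS f n) (⊛-identityʳ f n)

  ⊛-distribˡ : ∀ f g h → f ⊛ (g ⊕ h) ≋ f ⊛ g ⊕ f ⊛ h
  ⊛-distribˡ f g h n = trans (sumTo-cong (suc n) (λ k → distribˡ _ _ _)) (sumTo-+ _ _ (suc n))

  ⊛-distribʳ : ∀ f g h → (g ⊕ h) ⊛ f ≋ g ⊛ f ⊕ h ⊛ f
  ⊛-distribʳ f g h n = trans (sumTo-cong (suc n) (λ k → distribʳ _ _ _)) (sumTo-+ _ _ (suc n))

  ⊛-·ˡ : ∀ r f g → (r · f) ⊛ g ≋ r · (f ⊛ g)
  ⊛-·ˡ r f g n =
    trans (sumTo-cong (suc n) (λ k → *-assoc _ _ _)) (sym (*-distribˡ-sumTo r _ (suc n)))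

  ⊛-·ʳ : ∀ r f g → f ⊛ (r · g) ≋ r · (f ⊛ g)
  ⊛-·ʳ r f g n = trans (⊛-comm f (r · g) n) (trans (⊛-·ˡ r g f n) (*-congˡ (⊛-comm g f n)))

  ⊛-xMul : ∀ f g → f ⊛ xMul g ≋ xMul (f ⊛ g)
  ⊛-xMul f g zero    = trans (+-identityˡ _) (zeroʳ _)
  ⊛-xMul f g (suc n) = trans (+-cong
      (sumTo-cong-< (suc n) (λ k k≤n →
         *-congˡ (reflexive (≡.cong (xMul g) (ℕ.+-∸-assoc 1 (ℕ.m<1+n⇒m≤n k≤n))))))
      lastTerm)
    (+-identityʳ _)
    where
    lastTerm : f (suc n) * xMul g (suc n ∸ suc n) ≈ 0#
    lastTerm rewrite ℕ.n∸n≡0 n = zeroʳ _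

  x^∣-⊛ : ∀ {f g} i j → x^ i ∣ f → x^ j ∣ g → x^ (i +ℕ j) ∣ f ⊛ g
  x^∣-⊛ {f} {g} i j x^i∣f x^j∣g m m<i+j = sumTo-zero (suc m) term
    where
    term : ∀ k → k < suc m → f k * g (m ∸ k) ≈ 0#
    term k k≤m with k <? i
    ... | yes k<i = trans (*-congʳ (x^i∣f k k<i)) (zeroˡ _)
    ... | no  k≮i = trans (*-congˡ (x^j∣g (m ∸ k) m∸k<j)) (zeroʳ _)
      where
      i≤k : i ≤ k
      i≤k = ℕ.≮⇒≥ k≮i
      m∸k<j : m ∸ k < j
      m∸k<j = ℕ.≤-<-trans (ℕ.∸-monoʳ-≤ m i≤k)
        (≡.subst (m ∸ i <_) (ℕ.m+n∸m≡n i j)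
                 (ℕ.∸-monoˡ-< m<i+j (ℕ.≤-trans i≤k (ℕ.m<1+n⇒m≤n k≤m))))

  D-cong : ∀ {f g} → f ≋ g → D f ≋ D g
  D-cong f≋g n = *-congˡ (f≋g (suc n))

  D-onePS : ∀ n → D onePS n ≈ 0#
  D-onePS n = zeroʳ _

  D-· : ∀ r f → D (r · f) ≋ r · D f
  D-· r f n = solve 3 (λ m s y → m :* (s :* y) := s :* (m :* y)) refl (ι (suc n)) r (f (suc n))

  D-⊛ : ∀ f g → D (f ⊛ g) ≋ D f ⊛ g ⊕ f ⊛ D g
  D-⊛ f g n = begin
    ι (suc n) * sumTo (λ k → f k * g (suc n ∸ k)) (suc (suc n))
      ≈⟨ *-distribˡ-sumTo (ι (suc n)) _ (suc (suc n)) ⟩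
    sumTo (λ k → ι (suc n) * (f k * g (suc n ∸ k))) (suc (suc n))
      ≈⟨ sumTo-cong-< (suc (suc n)) (λ k k≤1+n → trans
           (*-congʳ (trans (reflexive (≡.cong ι (≡.sym (ℕ.m+[n∸m]≡n (ℕ.m<1+n⇒m≤n k≤1+n)))))
                           (ι-+ k (suc n ∸ k))))
           (distribʳ _ _ _)) ⟩
    sumTo (λ k → ι k * (f k * g (suc n ∸ k)) + ι (suc n ∸ k) * (f k * g (suc n ∸ k))) (suc (suc n))
      ≈⟨ sumTo-+ _ _ (suc (suc n)) ⟩
    sumTo (λ k → ι k * (f k * g (suc n ∸ k))) (suc (suc n))
      + sumTo (λ k → ι (suc n ∸ k) * (f k * g (suc n ∸ k))) (suc (suc n))
      ≈⟨ +-cong differentiateLeft differentiateRight ⟩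
    (D f ⊛ g) n + (f ⊛ D g) n ∎
    where
    differentiateLeft : sumTo (λ k → ι k * (f k * g (suc n ∸ k))) (suc (suc n)) ≈ (D f ⊛ g) n
    differentiateLeft = begin
      sumTo (λ k → ι k * (f k * g (suc n ∸ k))) (suc (suc n))
        ≈⟨ sumTo-head _ (suc n) ⟩
      0# * (f 0 * g (suc n)) + sumTo (λ k → ι (suc k) * (f (suc k) * g (n ∸ k))) (suc n)
        ≈⟨ trans (+-congʳ (zeroˡ _)) (+-identityˡ _) ⟩
      sumTo (λ k → ι (suc k) * (f (suc k) * g (n ∸ k))) (suc n)
        ≈⟨ sumTo-cong (suc n) (λ k → *-assoc _ _ _) ⟨
      (D f ⊛ g) n ∎
    lastTerm : ι (suc n ∸ suc n) * (f (suc n) * g (suc n ∸ suc n)) ≈ 0#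
    lastTerm rewrite ℕ.n∸n≡0 n = zeroˡ _
    differentiateRight :
      sumTo (λ k → ι (suc n ∸ k) * (f k * g (suc n ∸ k))) (suc (suc n)) ≈ (f ⊛ D g) n
    differentiateRight = trans
      (+-cong (sumTo-cong-< (suc n) (λ k k≤n → begin
                 ι (suc n ∸ k) * (f k * g (suc n ∸ k))
                   ≈⟨ reflexive (≡.cong (λ t → ι t * (f k * g t))
                                        (ℕ.+-∸-assoc 1 (ℕ.m<1+n⇒m≤n k≤n))) ⟩
                 ι (suc (n ∸ k)) * (f k * g (suc (n ∸ k)))
                   ≈⟨ solve 3 (λ m x y → m :* (x :* y) := x :* (m :* y)) refl _ _ _ ⟩
                 f k * D g (n ∸ k) ∎))
              lastTerm)
      (+-identityʳ _)

  pow-cong : ∀ {f g} → f ≋ g → ∀ k → pow f k ≋ pow g k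
  pow-cong f≋g zero    n = refl
  pow-cong f≋g (suc k)   = ⊛-cong f≋g (pow-cong f≋g k)

  D-pow : ∀ f k → D (pow f (suc k)) ≋ ι (suc k) · (D f ⊛ pow f k)
  D-pow f zero n = begin
    D (f ⊛ onePS) n      ≈⟨ D-cong (⊛-identityʳ f) n ⟩
    D f n                ≈⟨ ⊛-identityʳ (D f) n ⟨
    (D f ⊛ onePS) n      ≈⟨ *-identityˡ _ ⟨
    1# * (D f ⊛ onePS) n ≈⟨ *-congʳ (+-identityʳ 1#) ⟨
    ι 1 * (D f ⊛ onePS) n ∎
  D-pow f (suc k) n = begin
    D (f ⊛ pow f (suc k)) n
      ≈⟨ D-⊛ f (pow f (suc k)) n ⟩
    V n + (f ⊛ D (pow f (suc k))) n
      ≈⟨ +-congˡ (trans (⊛-congˡ f (D-pow f k) n) (⊛-·ʳ (ι (suc k)) f (D f ⊛ pow f k) n)) ⟩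
    V n + ι (suc k) * (f ⊛ (D f ⊛ pow f k)) n
      ≈⟨ +-congˡ (*-congˡ (x⊛yz≋y⊛xz f (D f) (pow f k) n)) ⟩
    V n + ι (suc k) * V n
      ≈⟨ solve 2 (λ v m → v :+ m :* v := (con 1 :+ m) :* v) refl (V n) (ι (suc k)) ⟩
    ι (suc (suc k)) * V n ∎
    where
    V : PS
    V = D f ⊛ pow f (suc k)

  D≋⊛-unique : ∀ F {Y Z} → D Y ≋ F ⊛ Y → D Z ≋ F ⊛ Z → Y 0 ≈ Z 0 → Y ≋ Z
  D≋⊛-unique F {Y} {Z} DY≋FY DZ≋FZ Y0≈Z0 = <-rec (λ n → Y n ≈ Z n) step
    where
    step : ∀ n → (∀ {m} → m < n → Y m ≈ Z m) → Y n ≈ Z n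
    step zero    _  = Y0≈Z0
    step (suc n) ih = begin
      Y (suc n)         ≈⟨ cancel-ι-suc n (DY≋FY n) ⟩
      inv n * (F ⊛ Y) n ≈⟨ *-congˡ (sumTo-cong (suc n) (λ j → *-congˡ (ih (s≤s (ℕ.m∸n≤m n j))))) ⟩
      inv n * (F ⊛ Z) n ≈⟨ cancel-ι-suc n (DZ≋FZ n) ⟨
      Z (suc n)         ∎

  recurrence-unique : ∀ {i} {I : Set i} (σ : I → I) (C : I → ℕ → Carrier)
    {Y Z : I → PS} →
    (∀ e → Y e 0 ≈ Z e 0) →
    (∀ e n → D (Y e) n ≈ Y (σ e) n * C e n) →
    (∀ e n → D (Z e) n ≈ Z (σ e) n * C e n) →
    ∀ n e → Y e n ≈ Z e n
  recurrence-unique σ C Y0≈Z0 DY DZ zero    e = Y0≈Z0 e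
  recurrence-unique σ C {Y} {Z} Y0≈Z0 DY DZ (suc n) e = begin
    Y e (suc n)                 ≈⟨ cancel-ι-suc n (DY e n) ⟩
    inv n * (Y (σ e) n * C e n) ≈⟨ *-congˡ (*-congʳ (recurrence-unique σ C {Y} {Z} Y0≈Z0 DY DZ n _)) ⟩
    inv n * (Z (σ e) n * C e n) ≈⟨ cancel-ι-suc n (DZ e n) ⟨
    Z e (suc n)                 ∎

  -- Σₖ wₖ Sₖ, cut off at k = n in degree n: the intended sum whenever x^ k ∣ S k.
  lincomb : (ℕ → Carrier) → (ℕ → PS) → PS
  lincomb w S n = sumTo (λ k → w k * S k n) (suc n)

  ⊛-lincomb : ∀ F w S → (∀ k → x^ k ∣ S k) →
    F ⊛ lincomb w S ≋ lincomb w (λ k → F ⊛ S k)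
  ⊛-lincomb F w S x^k∣S n = begin
    sumTo (λ i → F i * sumTo (λ k → w k * S k (n ∸ i)) (suc (n ∸ i))) (suc n)
      ≈⟨ sumTo-cong (suc n) (λ i → *-congˡ (sym (sumTo-truncate (suc (n ∸ i)) (suc n)
           (s≤s (ℕ.m∸n≤m n i))
           (λ k n∸i<k _ → trans (*-congˡ (x^k∣S k (n ∸ i) n∸i<k)) (zeroʳ _))))) ⟩
    sumTo (λ i → F i * sumTo (λ k → w k * S k (n ∸ i)) (suc n)) (suc n)
      ≈⟨ sumTo-cong (suc n) (λ i → *-distribˡ-sumTo (F i) _ (suc n)) ⟩
    sumTo (λ i → sumTo (λ k → F i * (w k * S k (n ∸ i))) (suc n)) (suc n)
      ≈⟨ sumTo-swap (λ i k → F i * (w k * S k (n ∸ i))) (suc n) (suc n) ⟩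
    sumTo (λ k → sumTo (λ i → F i * (w k * S k (n ∸ i))) (suc n)) (suc n)
      ≈⟨ sumTo-cong (suc n) (λ k → trans
           (sumTo-cong (suc n) (λ i →
              solve 3 (λ x y z → x :* (y :* z) := y :* (x :* z)) refl _ _ _))
           (sym (*-distribˡ-sumTo (w k) _ (suc n)))) ⟩
    sumTo (λ k → w k * (F ⊛ S k) n) (suc n) ∎

  x^∣pow : ∀ {h} → x^ 1 ∣ h → ∀ k → x^ k ∣ pow h k
  x^∣pow x∣h zero    m ()
  x^∣pow x∣h (suc k)   = x^∣-⊛ 1 k x∣h (x^∣pow x∣h k)

  dropConstant : PS → PS
  dropConstant f zero    = 0#
  dropConstant f (suc n) = f (suc n)

  x^∣pow-dropConstant : ∀ f k → x^ k ∣ pow (dropConstant f) k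
  x^∣pow-dropConstant f = x^∣pow (λ { zero _ → refl ; (suc _) (s≤s ()) })

  expPS-unfold : ∀ f → expPS f ≋ lincomb invFact (pow (dropConstant f))
  expPS-unfold f n =
    sumTo-cong (suc n) (λ k → *-congˡ (pow-cong (λ { zero → refl ; (suc _) → refl }) k n))

  logPS-unfold : ∀ g →
    logPS g ≋ λ n → sumTo (λ k → sgn k * inv k * pow (dropConstant g) (suc k) n) n
  logPS-unfold g n =
    sumTo-cong n (λ k → *-congˡ (pow-cong (λ { zero → refl ; (suc _) → refl }) (suc k) n))

  D-expPS : ∀ f → D (expPS f) ≋ D f ⊛ expPS f
  D-expPS f n = begin
    D (expPS f) n
      ≈⟨ D-cong (expPS-unfold f) n ⟩
    ι (suc n) * sumTo (λ k → invFact k * pow h k (suc n)) (suc (suc n))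
      ≈⟨ *-distribˡ-sumTo (ι (suc n)) _ (suc (suc n)) ⟩
    sumTo (λ k → ι (suc n) * (invFact k * pow h k (suc n))) (suc (suc n))
      ≈⟨ sumTo-cong (suc (suc n)) (λ k →
           solve 3 (λ m w y → m :* (w :* y) := w :* (m :* y)) refl _ _ _) ⟩
    sumTo (λ k → invFact k * D (pow h k) n) (suc (suc n))
      ≈⟨ sumTo-head _ (suc n) ⟩
    1# * D onePS n + sumTo (λ k → invFact (suc k) * D (pow h (suc k)) n) (suc n)
      ≈⟨ +-cong (trans (*-congˡ (D-onePS n)) (zeroʳ _)) (sumTo-cong (suc n) differentiateTerm) ⟩
    0# + lincomb invFact (λ k → D h ⊛ pow h k) n
      ≈⟨ +-identityˡ _ ⟩
    lincomb invFact (λ k → D h ⊛ pow h k) n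
      ≈⟨ ⊛-lincomb (D f) invFact (pow h) (x^∣pow-dropConstant f) n ⟨
    (D f ⊛ lincomb invFact (pow h)) n
      ≈⟨ ⊛-congˡ (D f) (expPS-unfold f) n ⟨
    (D f ⊛ expPS f) n ∎
    where
    h : PS
    h = dropConstant f
    differentiateTerm : ∀ k →
      invFact (suc k) * D (pow h (suc k)) n ≈ invFact k * (D h ⊛ pow h k) n
    differentiateTerm k = begin
      (inv k * invFact k) * D (pow h (suc k)) n
        ≈⟨ *-congˡ (D-pow h k n) ⟩
      (inv k * invFact k) * (ι (suc k) * V)
        ≈⟨ solve 4 (λ i w m y → (i :* w) :* (m :* y) := w :* (i :* (m :* y))) refl _ _ _ V ⟩
      invFact k * (inv k * (ι (suc k) * V))
        ≈⟨ *-congˡ (inv-cancelˡ k V) ⟩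
      invFact k * V ∎
      where
      V : Carrier
      V = (D h ⊛ pow h k) n

  D-logPS : ∀ g → D (logPS g) ≋ lincomb sgn (λ k → D g ⊛ pow (dropConstant g) k)
  D-logPS g n = begin
    D (logPS g) n
      ≈⟨ D-cong (logPS-unfold g) n ⟩
    ι (suc n) * sumTo (λ k → sgn k * inv k * pow h (suc k) (suc n)) (suc n)
      ≈⟨ *-distribˡ-sumTo (ι (suc n)) _ (suc n) ⟩
    sumTo (λ k → ι (suc n) * (sgn k * inv k * pow h (suc k) (suc n))) (suc n)
      ≈⟨ sumTo-cong (suc n) differentiateTerm ⟩
    lincomb sgn (λ k → D g ⊛ pow h k) n ∎
    where
    h : PS
    h = dropConstant g
    differentiateTerm : ∀ k →
      ι (suc n) * (sgn k * inv k * pow h (suc k) (suc n)) ≈ sgn k * (D g ⊛ pow h k) n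
    differentiateTerm k = begin
      ι (suc n) * (sgn k * inv k * pow h (suc k) (suc n))
        ≈⟨ solve 4 (λ m s i p → m :* (s :* i :* p) := s :* (i :* (m :* p))) refl _ _ _ _ ⟩
      sgn k * (inv k * D (pow h (suc k)) n)
        ≈⟨ *-congˡ (*-congˡ (D-pow h k n)) ⟩
      sgn k * (inv k * (ι (suc k) * (D g ⊛ pow h k) n))
        ≈⟨ *-congˡ (inv-cancelˡ k _) ⟩
      sgn k * (D g ⊛ pow h k) n ∎

  sgn-telescope : ∀ (x : ℕ → Carrier) m →
    sumTo (λ k → sgn k * (x k + x (suc k))) m + sgn m * x m ≈ x 0
  sgn-telescope x zero    = trans (+-identityˡ _) (*-identityˡ _)
  sgn-telescope x (suc m) = begin
    (sumTo (λ k → sgn k * (x k + x (suc k))) m + sgn m * (x m + x (suc m))) + - sgn m * x (suc m)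
      ≈⟨ solve 5 (λ S s t p q → (S :+ s :* (p :+ q)) :+ t :* q := (S :+ s :* p) :+ (s :+ t) :* q)
               refl _ (sgn m) (- sgn m) _ _ ⟩
    (sumTo (λ k → sgn k * (x k + x (suc k))) m + sgn m * x m) + (sgn m + - sgn m) * x (suc m)
      ≈⟨ +-cong (sgn-telescope x m) (trans (*-congʳ (-‿inverseʳ _)) (zeroˡ _)) ⟩
    x 0 + 0#
      ≈⟨ +-identityʳ _ ⟩
    x 0 ∎

  ⊛-D-logPS : ∀ g → g 0 ≈ 1# → g ⊛ D (logPS g) ≋ D g
  ⊛-D-logPS g g0≈1 n = begin
    (g ⊛ D (logPS g)) n
      ≈⟨ ⊛-congʳ (D (logPS g)) g≋1+h n ⟩
    ((onePS ⊕ h) ⊛ D (logPS g)) n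
      ≈⟨ ⊛-distribʳ (D (logPS g)) onePS h n ⟩
    (onePS ⊛ D (logPS g)) n + (h ⊛ D (logPS g)) n
      ≈⟨ +-cong (⊛-identityˡ (D (logPS g)) n) (⊛-congˡ h (D-logPS g) n) ⟩
    D (logPS g) n + (h ⊛ lincomb sgn V) n
      ≈⟨ +-cong (D-logPS g n) (⊛-lincomb h sgn V x^k∣V n) ⟩
    lincomb sgn V n + lincomb sgn (λ k → h ⊛ V k) n
      ≈⟨ sumTo-+ _ _ (suc n) ⟨
    sumTo (λ k → sgn k * V k n + sgn k * (h ⊛ V k) n) (suc n)
      ≈⟨ sumTo-cong (suc n) (λ k → trans (+-congˡ (*-congˡ (x⊛yz≋y⊛xz h (D g) (pow h k) n)))
                                         (sym (distribˡ _ _ _))) ⟩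
    sumTo (λ k → sgn k * (V k n + V (suc k) n)) (suc n)
      ≈⟨ +-identityʳ _ ⟨
    sumTo (λ k → sgn k * (V k n + V (suc k) n)) (suc n) + 0#
      ≈⟨ +-congˡ (trans (*-congˡ (x^k∣V (suc n) n ℕ.≤-refl)) (zeroʳ _)) ⟨
    sumTo (λ k → sgn k * (V k n + V (suc k) n)) (suc n) + sgn (suc n) * V (suc n) n
      ≈⟨ sgn-telescope (λ k → V k n) (suc n) ⟩
    (D g ⊛ onePS) n
      ≈⟨ ⊛-identityʳ (D g) n ⟩
    D g n ∎
    where
    h : PS
    h = dropConstant g
    V : ℕ → PS
    V k = D g ⊛ pow h k
    x^k∣V : ∀ k → x^ k ∣ V k
    x^k∣V k = x^∣-⊛ 0 k (λ _ ()) (x^∣pow-dropConstant g k)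
    g≋1+h : g ≋ onePS ⊕ h
    g≋1+h zero    = trans g0≈1 (sym (+-identityʳ 1#))
    g≋1+h (suc n) = sym (+-identityˡ _)

  module Powers (g : PS) where

    M : PS
    M = D (logPS g)

    powPS-constant : ∀ e → powPS g e 0 ≈ 1#
    powPS-constant e = trans (+-identityˡ _) (*-identityˡ _)

    D-powPS : ∀ e → D (powPS g e) ≋ e · (M ⊛ powPS g e)
    D-powPS e n = begin
      D (expPS (e · logPS g)) n                   ≈⟨ D-expPS (e · logPS g) n ⟩
      (D (e · logPS g) ⊛ powPS g e) n             ≈⟨ ⊛-congʳ (powPS g e) (D-· e (logPS g)) n ⟩
      ((e · M) ⊛ powPS g e) n                     ≈⟨ ⊛-·ˡ e M (powPS g e) n ⟩
      e * (M ⊛ powPS g e) n                       ∎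

    powPS-unique : ∀ e {Y} → D Y ≋ e · (M ⊛ Y) → Y 0 ≈ 1# → Y ≋ powPS g e
    powPS-unique e {Y} DY Y0≈1 = D≋⊛-unique (e · M)
      (λ n → trans (DY n) (sym (⊛-·ˡ e M Y n)))
      (λ n → trans (D-powPS e n) (sym (⊛-·ˡ e M (powPS g e) n)))
      (trans Y0≈1 (sym (powPS-constant e)))

    powPS-cong : ∀ {e e′} → e ≈ e′ → powPS g e ≋ powPS g e′
    powPS-cong {e} {e′} e≈e′ =
      powPS-unique e′ (λ n → trans (D-powPS e n) (*-congʳ e≈e′)) (powPS-constant e)

    powPS-0# : onePS ≋ powPS g 0#
    powPS-0# = powPS-unique 0# (λ n → trans (D-onePS n) (sym (zeroˡ _))) refl

    powPS-+ : ∀ e f → powPS g e ⊛ powPS g f ≋ powPS g (e + f)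
    powPS-+ e f = powPS-unique (e + f) D-product constant
      where
      E : Carrier → PS
      E = powPS g
      D-product : D (E e ⊛ E f) ≋ (e + f) · (M ⊛ (E e ⊛ E f))
      D-product n = begin
        D (E e ⊛ E f) n
          ≈⟨ D-⊛ (E e) (E f) n ⟩
        (D (E e) ⊛ E f) n + (E e ⊛ D (E f)) n
          ≈⟨ +-cong (⊛-congʳ (E f) (D-powPS e) n) (⊛-congˡ (E e) (D-powPS f) n) ⟩
        ((e · (M ⊛ E e)) ⊛ E f) n + (E e ⊛ (f · (M ⊛ E f))) n
          ≈⟨ +-cong (⊛-·ˡ e (M ⊛ E e) (E f) n) (⊛-·ʳ f (E e) (M ⊛ E f) n) ⟩
        e * ((M ⊛ E e) ⊛ E f) n + f * (E e ⊛ (M ⊛ E f)) n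
          ≈⟨ +-cong (*-congˡ (⊛-assoc M (E e) (E f) n)) (*-congˡ (x⊛yz≋y⊛xz (E e) M (E f) n)) ⟩
        e * (M ⊛ (E e ⊛ E f)) n + f * (M ⊛ (E e ⊛ E f)) n
          ≈⟨ distribʳ _ e f ⟨
        (e + f) * (M ⊛ (E e ⊛ E f)) n ∎
      constant : (E e ⊛ E f) 0 ≈ 1#
      constant = trans (+-identityˡ _)
                       (trans (*-cong (powPS-constant e) (powPS-constant f)) (*-identityˡ 1#))

    D≋M⊛ : g 0 ≈ 1# → D g ≋ M ⊛ g
    D≋M⊛ g0≈1 n = trans (sym (⊛-D-logPS g g0≈1 n)) (⊛-comm g M n)

    powPS-1# : g 0 ≈ 1# → g ≋ powPS g 1#
    powPS-1# g0≈1 = powPS-unique 1# (λ n → trans (D≋M⊛ g0≈1 n) (sym (*-identityˡ _))) g0≈1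

  module ODE (a b u : Carrier) (g : PS) (g0≈1 : g 0 ≈ 1#)
             (ode : D g ≋ u · powPS g (b + 1#) ⊕ a · xMul (powPS g b ⊛ D g)) where
    open Powers g

    N : Carrier → PS
    N e = M ⊛ powPS g e

    powPS-+-≈ : ∀ {e f e′} → e + f ≈ e′ → powPS g e ⊛ powPS g f ≋ powPS g e′
    powPS-+-≈ {e} {f} e+f≈e′ n = trans (powPS-+ e f n) (powPS-cong e+f≈e′ n)

    pred+1 : ∀ x → x + - 1# + 1# ≈ x
    pred+1 x = trans (+-assoc x _ 1#) (trans (+-congˡ (-‿inverseˡ 1#)) (+-identityʳ x))

    powPS-pred-⊛-D : ∀ e → powPS g (e + - 1#) ⊛ D g ≋ N e
    powPS-pred-⊛-D e n = begin
      (E₋ ⊛ D g) n             ≈⟨ ⊛-congˡ E₋ (D≋M⊛ g0≈1) n ⟩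
      (E₋ ⊛ (M ⊛ g)) n         ≈⟨ x⊛yz≋y⊛xz E₋ M g n ⟩
      (M ⊛ (E₋ ⊛ g)) n         ≈⟨ ⊛-congˡ M (⊛-congˡ E₋ (powPS-1# g0≈1)) n ⟩
      (M ⊛ (E₋ ⊛ powPS g 1#)) n ≈⟨ ⊛-congˡ M (powPS-+-≈ (pred+1 e)) n ⟩
      N e n                     ∎
      where
      E₋ : PS
      E₋ = powPS g (e + - 1#)

    N-recurrence : ∀ e → N e ≋ u · powPS g (e + b) ⊕ a · xMul (N (e + b))
    N-recurrence e n = begin
      N e n
        ≈⟨ powPS-pred-⊛-D e n ⟨
      (E₋ ⊛ D g) n
        ≈⟨ ⊛-congˡ E₋ ode n ⟩
      (E₋ ⊛ (u · powPS g (b + 1#) ⊕ a · xMul (powPS g b ⊛ D g))) n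
        ≈⟨ ⊛-distribˡ E₋ (u · powPS g (b + 1#)) (a · xMul (powPS g b ⊛ D g)) n ⟩
      (E₋ ⊛ (u · powPS g (b + 1#))) n + (E₋ ⊛ (a · xMul (powPS g b ⊛ D g))) n
        ≈⟨ +-cong (⊛-·ʳ u E₋ (powPS g (b + 1#)) n) (⊛-·ʳ a E₋ (xMul (powPS g b ⊛ D g)) n) ⟩
      u * (E₋ ⊛ powPS g (b + 1#)) n + a * (E₋ ⊛ xMul (powPS g b ⊛ D g)) n
        ≈⟨ +-cong (*-congˡ (powPS-+-≈ exponents₁ n))
                  (*-congˡ (trans (⊛-xMul E₋ (powPS g b ⊛ D g) n) (xMul-N n))) ⟩
      u * powPS g (e + b) n + a * xMul (N (e + b)) n ∎
      where
      E₋ : PS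
      E₋ = powPS g (e + - 1#)
      exponents₁ : e + - 1# + (b + 1#) ≈ e + b
      exponents₁ = trans (solve 3 (λ x y o → x :+ (y :+ o) := (x :+ o) :+ y) refl (e + - 1#) b 1#)
                         (+-congʳ (pred+1 e))
      exponents₂ : e + - 1# + b ≈ e + b + - 1#
      exponents₂ = solve 3 (λ x t y → (x :+ t) :+ y := (x :+ y) :+ t) refl e (- 1#) b
      E₋⊛powPS-⊛-D : E₋ ⊛ (powPS g b ⊛ D g) ≋ N (e + b)
      E₋⊛powPS-⊛-D m = begin
        (E₋ ⊛ (powPS g b ⊛ D g)) m           ≈⟨ ⊛-assoc E₋ (powPS g b) (D g) m ⟨
        ((E₋ ⊛ powPS g b) ⊛ D g) m           ≈⟨ ⊛-congʳ (D g) (powPS-+-≈ exponents₂) m ⟩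
        (powPS g (e + b + - 1#) ⊛ D g) m     ≈⟨ powPS-pred-⊛-D (e + b) m ⟩
        N (e + b) m                          ∎
      xMul-N : xMul (E₋ ⊛ (powPS g b ⊛ D g)) ≋ xMul (N (e + b))
      xMul-N zero    = refl
      xMul-N (suc m) = E₋⊛powPS-⊛-D m

    factor : Carrier → ℕ → Carrier
    factor e n = ι (suc n) * a + b * u + e * u

    N-constant : ∀ e → N e 0 ≈ u
    N-constant e = trans (N-recurrence e 0)
      (trans (+-cong (trans (*-congˡ (powPS-constant (e + b))) (*-identityʳ u)) (zeroʳ a))
             (+-identityʳ u))

    D-N : ∀ e n → D (N e) n ≈ N (e + b) n * factor e n
    D-N e n = begin
      ι (suc n) * N e (suc n)
        ≈⟨ *-congˡ (N-recurrence e (suc n)) ⟩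
      ι (suc n) * (u * powPS g (e + b) (suc n) + a * N (e + b) n)
        ≈⟨ solve 5 (λ m x y z w → m :* (x :* y :+ z :* w) := x :* (m :* y) :+ m :* z :* w)
                 refl _ u _ a _ ⟩
      u * D (powPS g (e + b)) n + ι (suc n) * a * N (e + b) n
        ≈⟨ +-congʳ (*-congˡ (D-powPS (e + b) n)) ⟩
      u * ((e + b) * N (e + b) n) + ι (suc n) * a * N (e + b) n
        ≈⟨ solve 6 (λ u e b y m a → u :* ((e :+ b) :* y) :+ m :* a :* y
                                    := y :* (m :* a :+ b :* u :+ e :* u))
                 refl u e b (N (e + b) n) (ι (suc n)) a ⟩
      N (e + b) n * factor e n ∎

    shiftedProduct : Carrier → ℕ → Carrier
    shiftedProduct e n = prodTo (λ j → ι (suc j) * a + ι (n ∸ j) * (b * u) + e * u) n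

    closedForm : Carrier → PS
    closedForm e n = u * shiftedProduct e n * invFact n

    shiftedProduct-suc : ∀ e n →
      shiftedProduct e (suc n) ≈ shiftedProduct (e + b) n * factor e n
    shiftedProduct-suc e n = *-cong (prodTo-cong-< n shiftFactor) lastFactor
      where
      shiftFactor : ∀ j → j < n →
        ι (suc j) * a + ι (suc n ∸ j) * (b * u) + e * u ≈
        ι (suc j) * a + ι (n ∸ j) * (b * u) + (e + b) * u
      shiftFactor j j<n = begin
        ι (suc j) * a + ι (suc n ∸ j) * (b * u) + e * u
          ≈⟨ +-congʳ (+-congˡ (*-congʳ (reflexive (≡.cong ι (ℕ.+-∸-assoc 1 (ℕ.<⇒≤ j<n)))))) ⟩
        ι (suc j) * a + (1# + ι (n ∸ j)) * (b * u) + e * u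
          ≈⟨ solve 6 (λ x a y b u e → x :* a :+ (con 1 :+ y) :* (b :* u) :+ e :* u
                                      := x :* a :+ y :* (b :* u) :+ (e :+ b) :* u) refl _ a _ b u e ⟩
        ι (suc j) * a + ι (n ∸ j) * (b * u) + (e + b) * u ∎
      lastFactor : ι (suc n) * a + ι (suc n ∸ n) * (b * u) + e * u ≈ factor e n
      lastFactor rewrite ℕ.m+n∸n≡m 1 n =
        +-congʳ (+-congˡ (trans (*-congʳ (+-identityʳ 1#)) (*-identityˡ (b * u))))

    D-closedForm : ∀ e n → D (closedForm e) n ≈ closedForm (e + b) n * factor e n
    D-closedForm e n = begin
      ι (suc n) * (u * shiftedProduct e (suc n) * (inv n * invFact n))
        ≈⟨ *-congˡ (*-congʳ (*-congˡ (shiftedProduct-suc e n))) ⟩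
      ι (suc n) * (u * (shiftedProduct (e + b) n * factor e n) * (inv n * invFact n))
        ≈⟨ solve 6 (λ m u R c i w → m :* (u :* (R :* c) :* (i :* w))
                                    := i :* (m :* (u :* R :* w :* c)))
                 refl _ u _ _ (inv n) _ ⟩
      inv n * (ι (suc n) * (closedForm (e + b) n * factor e n))
        ≈⟨ inv-cancelˡ n _ ⟩
      closedForm (e + b) n * factor e n ∎

    N≈closedForm : ∀ n e → N e n ≈ closedForm e n
    N≈closedForm = recurrence-unique (_+ b) factor
      (λ e → trans (N-constant e) (sym (trans (*-identityʳ _) (*-identityʳ u)))) D-N D-closedForm

    powPS-coefficient : ∀ e n → powPS g e n ≈ P n a (b * u) (e * u) * invFact n
    powPS-coefficient e zero    = trans (powPS-constant e) (sym (*-identityˡ _))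
    powPS-coefficient e (suc m) = begin
      powPS g e (suc m)
        ≈⟨ cancel-ι-suc m (D-powPS e m) ⟩
      inv m * (e * N e m)
        ≈⟨ *-congˡ (*-congˡ (N≈closedForm m e)) ⟩
      inv m * (e * (u * shiftedProduct e m * invFact m))
        ≈⟨ solve 5 (λ i e u R w → i :* (e :* (u :* R :* w)) := e :* u :* R :* (i :* w))
                 refl _ e u _ _ ⟩
      P (suc m) a (b * u) (e * u) * invFact (suc m) ∎

    logPS-coefficient : ∀ m → logPS g (suc m) ≈ u * Q (suc m) a (b * u) * invFact (suc m)
    logPS-coefficient m = begin
      logPS g (suc m)                           ≈⟨ cancel-ι-suc m refl ⟩
      inv m * M m                               ≈⟨ *-congˡ (⊛-identityʳ M m) ⟨
      inv m * (M ⊛ onePS) m                     ≈⟨ *-congˡ (⊛-congˡ M powPS-0# m) ⟩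
      inv m * N 0# m                            ≈⟨ *-congˡ (N≈closedForm m 0#) ⟩
      inv m * (u * shiftedProduct 0# m * invFact m)
        ≈⟨ *-congˡ (*-congʳ (*-congˡ (prodTo-cong-< m (λ j _ →
             trans (+-congˡ (zeroˡ u)) (+-identityʳ _))))) ⟩
      inv m * (u * Q (suc m) a (b * u) * invFact m)
        ≈⟨ solve 4 (λ i u R w → i :* (u :* R :* w) := u :* R :* (i :* w)) refl _ u _ _ ⟩
      u * Q (suc m) a (b * u) * invFact (suc m) ∎

open Defs
open QAlgebra using (Carrier; _≈_; _+_; _*_; 0#; 1#)

theorem5p1 : {c ℓ : Level} (A : QAlgebra c ℓ) →
    (a b u e : Carrier A) (g : PS A) →
    _≈_ A (g zero) (1# A) →
    (∀ n → _≈_ A (D A g n)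
                 (_⊕_ A (_·_ A u (powPS A g (_+_ A b (1# A))))
                        (_·_ A a (xMul A (_⊛_ A (powPS A g b) (D A g)))) n)) →
    (∀ n → _≈_ A (powPS A g e n)
                 (_*_ A (P A n a (_*_ A b u) (_*_ A e u)) (invFact A n)))
    × _≈_ A (logPS A g zero) (0# A)
    × (∀ m → _≈_ A (logPS A g (suc m))
                   (_*_ A (_*_ A u (Q A (suc m) a (_*_ A b u))) (invFact A (suc m))))
theorem5p1 A a b u e g g0≈1 ode = powPS-coefficient e , QAlgebra.refl A , logPS-coefficient
  where open FormalPowerSeries.ODE A a b u g g0≈1 ode
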